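{- The reduction relation $\rightarrow_{\beta\pi}$ of $\lambda\mathbf{J}$ is confluent.
   Context: $\lambda\mathbf{J}$: terms $t,u,v::=x\mid\lambda x.t\mid t(u,x.v)$, where $x$ is bound in $v$ (capture-avoiding substitution). A value $V$ is a variable or a $\lambda$-abstraction. Generalised arguments $R,S$ are pairs $(u,x.v)$, and $tRS$ means $(tR)S$. Append: $(u,x.V)@S=(u,x.VS)$ for $V$ a value, and $(u,x.tR')@S=(u,x.t(R'@S))$. The reduction is the closure under all constructors of: $(\beta)\ (\lambda x.t)(u,y.v)\rightarrow[[u/x]t/y]v$ and $(\pi)\ tRS\rightarrow t(R@S)$. Confluence: whenever $t\rightarrow^*t_1$ and $t\rightarrow^*t_2$ there is $t_3$ with $t_i\rightarrow^*t_3$. -}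

module Defs where

open import Data.Nat using (ℕ; zero; suc)
open import Relation.Binary.Construct.Closure.ReflexiveTransitive using (Star)
open import Data.Product using (∃; _×_)

-- Terms of λJ in de Bruijn notation.
--   var n        : variable
--   lam t        : λx.t        (x is index 0 in t)
--   app t u v    : t(u, x.v)   (x is index 0 in v; it is NOT bound in u)
data Tm : Set where
  var : ℕ → Tm
  lam : Tm → Tm
  app : Tm → Tm → Tm → Tm

data GArg : Set where
  garg : Tm → Tm → GArg   -- garg u v  represents  (u, x.v), x = index 0 in v

_·_ : Tm → GArg → Tm
t · garg u v = app t u v

Ren : Set
Ren = ℕ → ℕ

Sub : Set
Sub = ℕ → Tm

liftR : Ren → Ren
liftR ρ zero    = zero
liftR ρ (suc n) = suc (ρ n)

ren : Ren → Tm → Tm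
ren ρ (var n)     = var (ρ n)
ren ρ (lam t)     = lam (ren (liftR ρ) t)
ren ρ (app t u v) = app (ren ρ t) (ren ρ u) (ren (liftR ρ) v)

weaken : Tm → Tm
weaken = ren suc

liftS : Sub → Sub
liftS σ zero    = var zero
liftS σ (suc n) = weaken (σ n)

sub : Sub → Tm → Tm
sub σ (var n)     = σ n
sub σ (lam t)     = lam (sub (liftS σ) t)
sub σ (app t u v) = app (sub σ t) (sub σ u) (sub (liftS σ) v)

single : Tm → Sub
single u zero    = u
single u (suc n) = var n

_[_] : Tm → Tm → Tm
t [ u ] = sub (single u) t

weakenG : GArg → GArg
weakenG (garg u v) = garg (weaken u) (ren (liftR suc) v)

-- Append  R @ S :
--   (u, x.V) @ S      = (u, x. V S)
--   (u, x.t R') @ S   = (u, x. t (R' @ S))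
-- S is weakened when it goes under the binder x.
appendBody : Tm → GArg → Tm
appendBody (var n)     S = var n · S
appendBody (lam t)     S = lam t · S
appendBody (app t u v) S = app t u (appendBody v (weakenG S))

_＠_ : GArg → GArg → GArg
garg u v ＠ S = garg u (appendBody v (weakenG S))

data _↦_ : Tm → Tm → Set where
  β : ∀ {t u v} → app (lam t) u v ↦ (v [ t [ u ] ])
  π : ∀ {t R S} → ((t · R) · S) ↦ (t · (R ＠ S))

infix 4 _↦_ _⟶_ _⟶*_

data _⟶_ : Tm → Tm → Set where
  root : ∀ {t t'} → t ↦ t' → t ⟶ t'
  lamC : ∀ {t t'} → t ⟶ t' → lam t ⟶ lam t'
  app₁ : ∀ {t t' u v} → t ⟶ t' → app t u v ⟶ app t' u v
  app₂ : ∀ {t u u' v} → u ⟶ u' → app t u v ⟶ app t u' v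
  app₃ : ∀ {t u v v'} → v ⟶ v' → app t u v ⟶ app t u v'

_⟶*_ : Tm → Tm → Set
_⟶*_ = Star _⟶_

Confluent : Set
Confluent = ∀ {t t₁ t₂} → t ⟶* t₁ → t ⟶* t₂ → ∃ λ t₃ → (t₁ ⟶* t₃) × (t₂ ⟶* t₃)

-- Confluence follows from the Z property of zmap = develop ∘ pn. Here pn is π-normalisation
-- (generalised arguments are reassociated with append), and develop contracts bottom-up every
-- β-redex of a π-normal term, π-normalising each contractum. A π-step does not change pn, and
-- a β-step a → b is simulated on π-normal forms: pn a →β d with pn d = pn b. A β-step c →β d
-- out of a π-normal term is dominated by the development: d →* develop c and
-- develop c →* develop (pn d). Together, every step a → b satisfies b →* zmap a →* zmap b.

module Submission where

open import Defs
open import Data.Nat using (zero; suc; _+_)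
open import Data.Nat.Properties using (+-comm)
open import Data.Nat.GeneralisedArithmetic using (iterate)
open import Data.Product using (∃; _×_; _,_; proj₁; proj₂)
open import Data.Sum using (_⊎_; inj₁; inj₂)
import Data.Sum as Sum
open import Function using (_∘_)
open import Relation.Binary.Core using (Rel)
open import Relation.Binary.PropositionalEquality hiding ([_])
open import Relation.Binary.Construct.Closure.ReflexiveTransitive
  using (Star; ε; _◅_; _◅◅_; gmap; kleisliStar)
import Relation.Binary.Rewriting as Rewriting

-- Dehornoy and van Oostrom's Z property

HasZProperty : ∀ {a ℓ} {A : Set a} → Rel A ℓ → (A → A) → Set _
HasZProperty _⇒_ f = ∀ {x y} → x ⇒ y → Star _⇒_ y (f x) × Star _⇒_ (f x) (f y)

module _ {a ℓ} {A : Set a} {_⇒_ : Rel A ℓ} {f : A → A} (z : HasZProperty _⇒_ f) where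

  private
    _⇒*_ : Rel A _
    _⇒*_ = Star _⇒_

  Z-mono : ∀ {x y} → x ⇒* y → f x ⇒* f y
  Z-mono = kleisliStar f (proj₂ ∘ z)

  Z-iterate-mono : ∀ n {x y} → x ⇒* y → iterate f x n ⇒* iterate f y n
  Z-iterate-mono zero    r = r
  Z-iterate-mono (suc n) r = Z-iterate-mono n (Z-mono r)

  Z-reduct-⇒*-iterate : ∀ {x y} → x ⇒* y → ∃ λ n → y ⇒* iterate f x n
  Z-reduct-⇒*-iterate ε = zero , ε
  Z-reduct-⇒*-iterate (s ◅ ss) with Z-reduct-⇒*-iterate ss
  ... | n , r = suc n , (r ◅◅ Z-iterate-mono n (proj₁ (z s)))

  Z-iterate-ascending : ∀ {x} → x ⇒* f x → ∀ j k → iterate f x k ⇒* iterate f x (j + k)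
  Z-iterate-ascending r zero    k = ε
  Z-iterate-ascending r (suc j) k = Z-iterate-ascending r j k ◅◅ Z-iterate-mono (j + k) r

  -- Both reducts reach an iterate of f on the source, and once the source has a step
  -- x → y, x →* y →* f x makes the iterates ascending.
  Z⇒confluent : Rewriting.Confluent _⇒_
  Z⇒confluent ε r = _ , r , ε
  Z⇒confluent {x} (s ◅ ss) r
    with Z-reduct-⇒*-iterate (s ◅ ss) | Z-reduct-⇒*-iterate r
  ... | n , p | m , q =
    iterate f x (m + n) , (p ◅◅ up m n) ,
    (q ◅◅ subst (λ k → iterate f x m ⇒* iterate f x k) (+-comm n m) (up n m))
    where
    up : ∀ j k → iterate f x k ⇒* iterate f x (j + k)
    up = Z-iterate-ascending (s ◅ proj₁ (z s))

cong₃ : ∀ {A B C D : Set} (f : A → B → C → D) {a a' b b' c c'} →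
        a ≡ a' → b ≡ b' → c ≡ c' → f a b c ≡ f a' b' c'
cong₃ f refl refl refl = refl

≡⇒⟶* : ∀ {a b} → a ≡ b → a ⟶* b
≡⇒⟶* refl = ε

-- Renaming and substitution

liftR-cong : ∀ {ρ ρ' : Ren} → (∀ n → ρ n ≡ ρ' n) → ∀ n → liftR ρ n ≡ liftR ρ' n
liftR-cong e zero    = refl
liftR-cong e (suc n) = cong suc (e n)

ren-cong : ∀ {ρ ρ' : Ren} → (∀ n → ρ n ≡ ρ' n) → ∀ t → ren ρ t ≡ ren ρ' t
ren-cong e (var n)     = cong var (e n)
ren-cong e (lam t)     = cong lam (ren-cong (liftR-cong e) t)
ren-cong e (app t u v) = cong₃ app (ren-cong e t) (ren-cong e u) (ren-cong (liftR-cong e) v)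

liftR-∘ : ∀ (ρ ρ' : Ren) n → liftR ρ (liftR ρ' n) ≡ liftR (ρ ∘ ρ') n
liftR-∘ ρ ρ' zero    = refl
liftR-∘ ρ ρ' (suc n) = refl

ren-ren : ∀ (ρ ρ' : Ren) t → ren ρ (ren ρ' t) ≡ ren (ρ ∘ ρ') t
ren-ren ρ ρ' (var n)     = refl
ren-ren ρ ρ' (lam t)     =
  cong lam (trans (ren-ren (liftR ρ) (liftR ρ') t) (ren-cong (liftR-∘ ρ ρ') t))
ren-ren ρ ρ' (app t u v) = cong₃ app (ren-ren ρ ρ' t) (ren-ren ρ ρ' u)
  (trans (ren-ren (liftR ρ) (liftR ρ') v) (ren-cong (liftR-∘ ρ ρ') v))

liftS-cong : ∀ {σ σ' : Sub} → (∀ n → σ n ≡ σ' n) → ∀ n → liftS σ n ≡ liftS σ' n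
liftS-cong e zero    = refl
liftS-cong e (suc n) = cong weaken (e n)

sub-cong : ∀ {σ σ' : Sub} → (∀ n → σ n ≡ σ' n) → ∀ t → sub σ t ≡ sub σ' t
sub-cong e (var n)     = e n
sub-cong e (lam t)     = cong lam (sub-cong (liftS-cong e) t)
sub-cong e (app t u v) = cong₃ app (sub-cong e t) (sub-cong e u) (sub-cong (liftS-cong e) v)

ren-weaken : ∀ (ρ : Ren) t → ren (liftR ρ) (weaken t) ≡ weaken (ren ρ t)
ren-weaken ρ t = trans (ren-ren (liftR ρ) suc t) (sym (ren-ren suc ρ t))

liftR-liftS : ∀ (ρ : Ren) (σ : Sub) n → ren (liftR ρ) (liftS σ n) ≡ liftS (ren ρ ∘ σ) n
liftR-liftS ρ σ zero    = refl
liftR-liftS ρ σ (suc n) = ren-weaken ρ (σ n)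

ren-sub : ∀ (ρ : Ren) (σ : Sub) t → ren ρ (sub σ t) ≡ sub (ren ρ ∘ σ) t
ren-sub ρ σ (var n)     = refl
ren-sub ρ σ (lam t)     =
  cong lam (trans (ren-sub (liftR ρ) (liftS σ) t) (sub-cong (liftR-liftS ρ σ) t))
ren-sub ρ σ (app t u v) = cong₃ app (ren-sub ρ σ t) (ren-sub ρ σ u)
  (trans (ren-sub (liftR ρ) (liftS σ) v) (sub-cong (liftR-liftS ρ σ) v))

liftS-liftR : ∀ (σ : Sub) (ρ : Ren) n → liftS σ (liftR ρ n) ≡ liftS (σ ∘ ρ) n
liftS-liftR σ ρ zero    = refl
liftS-liftR σ ρ (suc n) = refl

sub-ren : ∀ (σ : Sub) (ρ : Ren) t → sub σ (ren ρ t) ≡ sub (σ ∘ ρ) t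
sub-ren σ ρ (var n)     = refl
sub-ren σ ρ (lam t)     =
  cong lam (trans (sub-ren (liftS σ) (liftR ρ) t) (sub-cong (liftS-liftR σ ρ) t))
sub-ren σ ρ (app t u v) = cong₃ app (sub-ren σ ρ t) (sub-ren σ ρ u)
  (trans (sub-ren (liftS σ) (liftR ρ) v) (sub-cong (liftS-liftR σ ρ) v))

sub-weaken : ∀ (σ : Sub) t → sub (liftS σ) (weaken t) ≡ weaken (sub σ t)
sub-weaken σ t = trans (sub-ren (liftS σ) suc t) (sym (ren-sub suc σ t))

liftS-liftS : ∀ (σ τ : Sub) n → sub (liftS σ) (liftS τ n) ≡ liftS (sub σ ∘ τ) n
liftS-liftS σ τ zero    = refl
liftS-liftS σ τ (suc n) = sub-weaken σ (τ n)

sub-sub : ∀ (σ τ : Sub) t → sub σ (sub τ t) ≡ sub (sub σ ∘ τ) t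
sub-sub σ τ (var n)     = refl
sub-sub σ τ (lam t)     =
  cong lam (trans (sub-sub (liftS σ) (liftS τ) t) (sub-cong (liftS-liftS σ τ) t))
sub-sub σ τ (app t u v) = cong₃ app (sub-sub σ τ t) (sub-sub σ τ u)
  (trans (sub-sub (liftS σ) (liftS τ) v) (sub-cong (liftS-liftS σ τ) v))

liftS-var : ∀ n → liftS var n ≡ var n
liftS-var zero    = refl
liftS-var (suc n) = refl

sub-var : ∀ t → sub var t ≡ t
sub-var (var n)     = refl
sub-var (lam t)     = cong lam (trans (sub-cong liftS-var t) (sub-var t))
sub-var (app t u v) =
  cong₃ app (sub-var t) (sub-var u) (trans (sub-cong liftS-var v) (sub-var v))

weaken-[] : ∀ t w → weaken t [ w ] ≡ t
weaken-[] t w = trans (sub-ren (single w) suc t) (sub-var t)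

sub-[] : ∀ (σ : Sub) v w → sub σ (v [ w ]) ≡ sub (liftS σ) v [ sub σ w ]
sub-[] σ v w = begin
  sub σ (v [ w ])                          ≡⟨ sub-sub σ (single w) v ⟩
  sub (sub σ ∘ single w) v                 ≡⟨ sub-cong pointwise v ⟩
  sub (sub (single (sub σ w)) ∘ liftS σ) v ≡⟨ sub-sub (single (sub σ w)) (liftS σ) v ⟨
  sub (liftS σ) v [ sub σ w ]              ∎
  where
  open ≡-Reasoning
  pointwise : ∀ n → sub σ (single w n) ≡ sub (single (sub σ w)) (liftS σ n)
  pointwise zero    = refl
  pointwise (suc n) = sym (weaken-[] (σ n) (sub σ w))

ren-[] : ∀ (ρ : Ren) v w → ren ρ (v [ w ]) ≡ ren (liftR ρ) v [ ren ρ w ]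
ren-[] ρ v w = begin
  ren ρ (v [ w ])                          ≡⟨ ren-sub ρ (single w) v ⟩
  sub (ren ρ ∘ single w) v                 ≡⟨ sub-cong pointwise v ⟩
  sub (single (ren ρ w) ∘ liftR ρ) v       ≡⟨ sub-ren (single (ren ρ w)) (liftR ρ) v ⟨
  ren (liftR ρ) v [ ren ρ w ]              ∎
  where
  open ≡-Reasoning
  pointwise : ∀ n → ren ρ (single w n) ≡ single (ren ρ w) (liftR ρ n)
  pointwise zero    = refl
  pointwise (suc n) = refl

ren-β-contractum : ∀ (ρ : Ren) t u v →
  ren ρ (v [ t [ u ] ]) ≡ ren (liftR ρ) v [ ren (liftR ρ) t [ ren ρ u ] ]
ren-β-contractum ρ t u v =
  trans (ren-[] ρ v (t [ u ])) (cong (ren (liftR ρ) v [_]) (ren-[] ρ t u))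

sub-β-contractum : ∀ (σ : Sub) t u v →
  sub σ (v [ t [ u ] ]) ≡ sub (liftS σ) v [ sub (liftS σ) t [ sub σ u ] ]
sub-β-contractum σ t u v =
  trans (sub-[] σ v (t [ u ])) (cong (sub (liftS σ) v [_]) (sub-[] σ t u))

ren-liftR-weaken : ∀ (ρ : Ren) v →
  ren (liftR (liftR ρ)) (ren (liftR suc) v) ≡ ren (liftR suc) (ren (liftR ρ) v)
ren-liftR-weaken ρ v = trans (ren-ren (liftR (liftR ρ)) (liftR suc) v)
  (trans (ren-cong pointwise v) (sym (ren-ren (liftR suc) (liftR ρ) v)))
  where
  pointwise : ∀ n → liftR (liftR ρ) (liftR suc n) ≡ liftR suc (liftR ρ n)
  pointwise zero    = refl
  pointwise (suc n) = refl

sub-liftR-weaken : ∀ (σ : Sub) v →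
  sub (liftS (liftS σ)) (ren (liftR suc) v) ≡ ren (liftR suc) (sub (liftS σ) v)
sub-liftR-weaken σ v = trans (sub-ren (liftS (liftS σ)) (liftR suc) v)
  (trans (sub-cong pointwise v) (sym (ren-sub (liftR suc) (liftS σ) v)))
  where
  pointwise : ∀ n → liftS (liftS σ) (liftR suc n) ≡ ren (liftR suc) (liftS σ n)
  pointwise zero    = refl
  pointwise (suc n) = sym (ren-weaken suc (σ n))

liftS-single-liftR-weaken : ∀ w v → sub (liftS (single w)) (ren (liftR suc) v) ≡ v
liftS-single-liftR-weaken w v =
  trans (sub-ren (liftS (single w)) (liftR suc) v) (trans (sub-cong pointwise v) (sub-var v))
  where
  pointwise : ∀ n → liftS (single w) (liftR suc n) ≡ var n
  pointwise zero    = refl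
  pointwise (suc n) = refl

renG : Ren → GArg → GArg
renG ρ (garg u v) = garg (ren ρ u) (ren (liftR ρ) v)

subG : Sub → GArg → GArg
subG σ (garg u v) = garg (sub σ u) (sub (liftS σ) v)

renG-weakenG : ∀ (ρ : Ren) S → renG (liftR ρ) (weakenG S) ≡ weakenG (renG ρ S)
renG-weakenG ρ (garg u v) = cong₂ garg (ren-weaken ρ u) (ren-liftR-weaken ρ v)

subG-weakenG : ∀ (σ : Sub) S → subG (liftS σ) (weakenG S) ≡ weakenG (subG σ S)
subG-weakenG σ (garg u v) = cong₂ garg (sub-weaken σ u) (sub-liftR-weaken σ v)

weakenG-renG : ∀ S → weakenG S ≡ renG suc S
weakenG-renG (garg u v) = refl

subG-single-weakenG : ∀ w S → subG (single w) (weakenG S) ≡ S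
subG-single-weakenG w (garg u v) = cong₂ garg (weaken-[] u w) (liftS-single-liftR-weaken w v)

ren-appendBody : ∀ (ρ : Ren) v S → ren ρ (appendBody v S) ≡ appendBody (ren ρ v) (renG ρ S)
ren-appendBody ρ (var n)     (garg a b) = refl
ren-appendBody ρ (lam t)     (garg a b) = refl
ren-appendBody ρ (app t u v) S          = cong (app (ren ρ t) (ren ρ u))
  (trans (ren-appendBody (liftR ρ) v (weakenG S))
         (cong (appendBody (ren (liftR ρ) v)) (renG-weakenG ρ S)))

appendBody-assoc : ∀ h u v S →
  appendBody (appendBody h (garg u v)) S ≡ appendBody h (garg u (appendBody v (weakenG S)))
appendBody-assoc (var n)     u v S = refl
appendBody-assoc (lam t)     u v S = refl
appendBody-assoc (app a b c) u v S = cong (app a b)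
  (trans (appendBody-assoc c (weaken u) (ren (liftR suc) v) (weakenG S))
         (cong (λ z → appendBody c (garg (weaken u) z)) (sym
           (trans (ren-appendBody (liftR suc) v (weakenG S))
                  (cong (appendBody (ren (liftR suc) v))
                        (trans (renG-weakenG suc S) (cong weakenG (sym (weakenG-renG S)))))))))

-- π-normal forms

pn : Tm → Tm
pn (var n)     = var n
pn (lam t)     = lam (pn t)
pn (app t u v) = appendBody (pn t) (garg (pn u) (pn v))

pnG : GArg → GArg
pnG (garg u v) = garg (pn u) (pn v)

appendBody-cong : ∀ {h h' u u' v v'} → h ≡ h' → u ≡ u' → v ≡ v' →
                  appendBody h (garg u v) ≡ appendBody h' (garg u' v')
appendBody-cong = cong₃ (λ h u v → appendBody h (garg u v))

pn-ren : ∀ (ρ : Ren) t → pn (ren ρ t) ≡ ren ρ (pn t)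
pn-ren ρ (var n)     = refl
pn-ren ρ (lam t)     = cong lam (pn-ren (liftR ρ) t)
pn-ren ρ (app t u v) = trans (appendBody-cong (pn-ren ρ t) (pn-ren ρ u) (pn-ren (liftR ρ) v))
                             (sym (ren-appendBody ρ (pn t) (pnG (garg u v))))

pnG-weakenG : ∀ S → pnG (weakenG S) ≡ weakenG (pnG S)
pnG-weakenG (garg u v) = cong₂ garg (pn-ren suc u) (pn-ren (liftR suc) v)

pn-appendBody : ∀ v S → pn (appendBody v S) ≡ appendBody (pn v) (pnG S)
pn-appendBody (var n)     (garg a b) = refl
pn-appendBody (lam t)     (garg a b) = refl
pn-appendBody (app a b c) S          =
  trans (cong (λ z → appendBody (pn a) (garg (pn b) z))
          (trans (pn-appendBody c (weakenG S)) (cong (appendBody (pn c)) (pnG-weakenG S))))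
        (sym (appendBody-assoc (pn a) (pn b) (pn c) (pnG S)))

pn-idem : ∀ t → pn (pn t) ≡ pn t
pn-idem (var n)     = refl
pn-idem (lam t)     = cong lam (pn-idem t)
pn-idem (app t u v) = trans (pn-appendBody (pn t) (pnG (garg u v)))
                            (appendBody-cong (pn-idem t) (pn-idem u) (pn-idem v))

pn-π : ∀ {t R S} → pn ((t · R) · S) ≡ pn (t · (R ＠ S))
pn-π {t} {garg u₁ v₁} {S@(garg _ _)} =
  trans (appendBody-assoc (pn t) (pn u₁) (pn v₁) (pnG S))
        (cong (λ z → appendBody (pn t) (garg (pn u₁) z)) (sym
          (trans (pn-appendBody v₁ (weakenG S)) (cong (appendBody (pn v₁)) (pnG-weakenG S)))))

pn-sub-appendBody : ∀ (σ : Sub) v S →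
  pn (sub σ (appendBody v S)) ≡ appendBody (pn (sub σ v)) (pnG (subG σ S))
pn-sub-appendBody σ (var k)     (garg a b) = refl
pn-sub-appendBody σ (lam t)     (garg a b) = refl
pn-sub-appendBody σ (app a b c) S          =
  trans (cong (λ z → appendBody (pn (sub σ a)) (garg (pn (sub σ b)) z))
          (trans (pn-sub-appendBody (liftS σ) c (weakenG S))
                 (cong (appendBody (pn (sub (liftS σ) c)))
                   (trans (cong pnG (subG-weakenG σ S)) (pnG-weakenG (subG σ S))))))
        (sym (appendBody-assoc (pn (sub σ a)) (pn (sub σ b)) (pn (sub (liftS σ) c))
                               (pnG (subG σ S))))

pn-sub-pn : ∀ (σ : Sub) t → pn (sub σ t) ≡ pn (sub σ (pn t))
pn-sub-pn σ (var n)     = refl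
pn-sub-pn σ (lam t)     = cong lam (pn-sub-pn (liftS σ) t)
pn-sub-pn σ (app t u v) =
  trans (appendBody-cong (pn-sub-pn σ t) (pn-sub-pn σ u) (pn-sub-pn (liftS σ) v))
        (sym (pn-sub-appendBody σ (pn t) (pnG (garg u v))))

liftS-pn : ∀ {σ σ' : Sub} → (∀ n → pn (σ n) ≡ pn (σ' n)) →
           ∀ n → pn (liftS σ n) ≡ pn (liftS σ' n)
liftS-pn          e zero    = refl
liftS-pn {σ} {σ'} e (suc n) =
  trans (pn-ren suc (σ n)) (trans (cong weaken (e n)) (sym (pn-ren suc (σ' n))))

pn-sub-cong : ∀ {σ σ' : Sub} → (∀ n → pn (σ n) ≡ pn (σ' n)) →
              ∀ t → pn (sub σ t) ≡ pn (sub σ' t)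
pn-sub-cong e (var n)     = e n
pn-sub-cong e (lam t)     = cong lam (pn-sub-cong (liftS-pn e) t)
pn-sub-cong e (app t u v) =
  appendBody-cong (pn-sub-cong e t) (pn-sub-cong e u) (pn-sub-cong (liftS-pn e) v)

pn-[]-cong : ∀ {w w'} → pn w ≡ pn w' → ∀ v → pn (v [ w ]) ≡ pn (v [ w' ])
pn-[]-cong {w} {w'} e = pn-sub-cong pointwise
  where
  pointwise : ∀ n → pn (single w n) ≡ pn (single w' n)
  pointwise zero    = e
  pointwise (suc n) = refl

pn-[]-pn : ∀ t u → pn (pn t [ pn u ]) ≡ pn (t [ u ])
pn-[]-pn t u = trans (sym (pn-sub-pn (single (pn u)) t)) (pn-[]-cong (pn-idem u) t)

data πNF : Tm → Set where
  nvar : ∀ {n} → πNF (var n)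
  nlam : ∀ {t} → πNF t → πNF (lam t)
  napv : ∀ {n u v} → πNF u → πNF v → πNF (app (var n) u v)
  napl : ∀ {t u v} → πNF t → πNF u → πNF v → πNF (app (lam t) u v)

πNF-ren : ∀ (ρ : Ren) {t} → πNF t → πNF (ren ρ t)
πNF-ren ρ nvar         = nvar
πNF-ren ρ (nlam x)     = nlam (πNF-ren (liftR ρ) x)
πNF-ren ρ (napv x y)   = napv (πNF-ren ρ x) (πNF-ren (liftR ρ) y)
πNF-ren ρ (napl x y z) = napl (πNF-ren (liftR ρ) x) (πNF-ren ρ y) (πNF-ren (liftR ρ) z)

πNF-appendBody : ∀ {h u v} → πNF h → πNF u → πNF v → πNF (appendBody h (garg u v))
πNF-appendBody nvar         nu nv = napv nu nv
πNF-appendBody (nlam x)     nu nv = napl x nu nv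
πNF-appendBody (napv x y)   nu nv = napv x (πNF-appendBody y (πNF-ren suc nu) (πNF-ren (liftR suc) nv))
πNF-appendBody (napl w x y) nu nv = napl w x (πNF-appendBody y (πNF-ren suc nu) (πNF-ren (liftR suc) nv))

πNF-pn : ∀ t → πNF (pn t)
πNF-pn (var n)     = nvar
πNF-pn (lam t)     = nlam (πNF-pn t)
πNF-pn (app t u v) = πNF-appendBody (πNF-pn t) (πNF-pn u) (πNF-pn v)

πNF⇒pn-id : ∀ {t} → πNF t → pn t ≡ t
πNF⇒pn-id nvar         = refl
πNF⇒pn-id (nlam x)     = cong lam (πNF⇒pn-id x)
πNF⇒pn-id (napv x y)   = cong₂ (app (var _)) (πNF⇒pn-id x) (πNF⇒pn-id y)
πNF⇒pn-id (napl x y z) = cong₃ (λ a b c → app (lam a) b c) (πNF⇒pn-id x) (πNF⇒pn-id y) (πNF⇒pn-id z)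

infix 4 _⟶β_

data _⟶β_ : Tm → Tm → Set where
  rootβ : ∀ {t u v} → app (lam t) u v ⟶β (v [ t [ u ] ])
  lamβ  : ∀ {t t'} → t ⟶β t' → lam t ⟶β lam t'
  app₁β : ∀ {t t' u v} → t ⟶β t' → app t u v ⟶β app t' u v
  app₂β : ∀ {t u u' v} → u ⟶β u' → app t u v ⟶β app t u' v
  app₃β : ∀ {t u v v'} → v ⟶β v' → app t u v ⟶β app t u v'

⟶β⇒⟶ : ∀ {a b} → a ⟶β b → a ⟶ b
⟶β⇒⟶ rootβ     = root β
⟶β⇒⟶ (lamβ s)  = lamC (⟶β⇒⟶ s)
⟶β⇒⟶ (app₁β s) = app₁ (⟶β⇒⟶ s)
⟶β⇒⟶ (app₂β s) = app₂ (⟶β⇒⟶ s)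
⟶β⇒⟶ (app₃β s) = app₃ (⟶β⇒⟶ s)

⟶⇒⟶β⊎pn≡ : ∀ {a b} → a ⟶ b → (a ⟶β b) ⊎ (pn a ≡ pn b)
⟶⇒⟶β⊎pn≡ (root β) = inj₁ rootβ
⟶⇒⟶β⊎pn≡ (root (π {t} {R} {S})) = inj₂ (pn-π {t} {R} {S})
⟶⇒⟶β⊎pn≡ (lamC s) = Sum.map lamβ (cong lam) (⟶⇒⟶β⊎pn≡ s)
⟶⇒⟶β⊎pn≡ (app₁ {u = u} {v} s) =
  Sum.map app₁β (cong (λ z → appendBody z (garg (pn u) (pn v)))) (⟶⇒⟶β⊎pn≡ s)
⟶⇒⟶β⊎pn≡ (app₂ {t} {v = v} s) =
  Sum.map app₂β (cong (λ z → appendBody (pn t) (garg z (pn v)))) (⟶⇒⟶β⊎pn≡ s)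
⟶⇒⟶β⊎pn≡ (app₃ {t} {u} s) =
  Sum.map app₃β (cong (λ z → appendBody (pn t) (garg (pn u) z))) (⟶⇒⟶β⊎pn≡ s)

lam* : ∀ {a b} → a ⟶* b → lam a ⟶* lam b
lam* = gmap lam lamC

app₃* : ∀ {t u a b} → a ⟶* b → app t u a ⟶* app t u b
app₃* {t} {u} = gmap (app t u) app₃

app* : ∀ {t t' u u' v v'} → t ⟶* t' → u ⟶* u' → v ⟶* v' → app t u v ⟶* app t' u' v'
app* {t' = t'} {u} {v = v} r₁ r₂ r₃ =
  gmap (λ x → app x u v) app₁ r₁ ◅◅ gmap (λ x → app t' x v) app₂ r₂ ◅◅ app₃* r₃

app⟶*appendBody : ∀ h u v → app h u v ⟶* appendBody h (garg u v)
app⟶*appendBody (var n)     u v = ε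
app⟶*appendBody (lam t)     u v = ε
app⟶*appendBody (app a b c) u v = root (π {a} {garg b c} {garg u v}) ◅ ε

⟶*pn : ∀ t → t ⟶* pn t
⟶*pn (var n)     = ε
⟶*pn (lam t)     = lam* (⟶*pn t)
⟶*pn (app t u v) = app* (⟶*pn t) (⟶*pn u) (⟶*pn v) ◅◅ app⟶*appendBody (pn t) (pn u) (pn v)

ren-⟶ : ∀ (ρ : Ren) {a b} → a ⟶ b → ren ρ a ⟶ ren ρ b
ren-⟶ ρ (root (β {t} {u} {v})) =
  subst (app (lam (ren (liftR ρ) t)) (ren ρ u) (ren (liftR ρ) v) ⟶_)
        (sym (ren-β-contractum ρ t u v)) (root β)
ren-⟶ ρ (root (π {t} {garg u₁ v₁} {S@(garg u₂ v₂)})) =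
  subst (app (app (ren ρ t) (ren ρ u₁) (ren (liftR ρ) v₁)) (ren ρ u₂) (ren (liftR ρ) v₂) ⟶_)
        (cong (app (ren ρ t) (ren ρ u₁)) (sym
          (trans (ren-appendBody (liftR ρ) v₁ (weakenG S))
                 (cong (appendBody (ren (liftR ρ) v₁)) (renG-weakenG ρ S)))))
        (root π)
ren-⟶ ρ (lamC s) = lamC (ren-⟶ (liftR ρ) s)
ren-⟶ ρ (app₁ s) = app₁ (ren-⟶ ρ s)
ren-⟶ ρ (app₂ s) = app₂ (ren-⟶ ρ s)
ren-⟶ ρ (app₃ s) = app₃ (ren-⟶ (liftR ρ) s)

ren-⟶* : ∀ (ρ : Ren) {a b} → a ⟶* b → ren ρ a ⟶* ren ρ b
ren-⟶* ρ = gmap (ren ρ) (ren-⟶ ρ)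

ren-⟶β : ∀ (ρ : Ren) {a b} → a ⟶β b → ren ρ a ⟶β ren ρ b
ren-⟶β ρ (rootβ {t} {u} {v}) =
  subst (app (lam (ren (liftR ρ) t)) (ren ρ u) (ren (liftR ρ) v) ⟶β_)
        (sym (ren-β-contractum ρ t u v)) rootβ
ren-⟶β ρ (lamβ s)  = lamβ (ren-⟶β (liftR ρ) s)
ren-⟶β ρ (app₁β s) = app₁β (ren-⟶β ρ s)
ren-⟶β ρ (app₂β s) = app₂β (ren-⟶β ρ s)
ren-⟶β ρ (app₃β s) = app₃β (ren-⟶β (liftR ρ) s)

sub-⟶β : ∀ (σ : Sub) {a b} → a ⟶β b → sub σ a ⟶β sub σ b
sub-⟶β σ (rootβ {t} {u} {v}) =
  subst (app (lam (sub (liftS σ) t)) (sub σ u) (sub (liftS σ) v) ⟶β_)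
        (sym (sub-β-contractum σ t u v)) rootβ
sub-⟶β σ (lamβ s)  = lamβ (sub-⟶β (liftS σ) s)
sub-⟶β σ (app₁β s) = app₁β (sub-⟶β σ s)
sub-⟶β σ (app₂β s) = app₂β (sub-⟶β σ s)
sub-⟶β σ (app₃β s) = app₃β (sub-⟶β (liftS σ) s)

-- Simulation on π-normal forms

appendBody-⟶β-head : ∀ S {h h'} → h ⟶β h' →
  ∃ λ e → (appendBody h S ⟶β e) × (pn e ≡ pn (appendBody h' S))
appendBody-⟶β-head S (rootβ {t} {u} {v}) =
  appendBody v (weakenG S) [ t [ u ] ] , rootβ ,
  trans (pn-sub-appendBody (single (t [ u ])) v (weakenG S))
    (trans (cong (λ z → appendBody (pn (v [ t [ u ] ])) (pnG z)) (subG-single-weakenG (t [ u ]) S))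
           (sym (pn-appendBody (v [ t [ u ] ]) S)))
appendBody-⟶β-head (garg a b) (lamβ {t' = t'} s) = app (lam t') a b , app₁β (lamβ s) , refl
appendBody-⟶β-head S (app₁β {t' = t'} {u} {v} s) =
  app t' u (appendBody v (weakenG S)) , app₁β s , refl
appendBody-⟶β-head S (app₂β {t} {u' = u'} {v} s) =
  app t u' (appendBody v (weakenG S)) , app₂β s , refl
appendBody-⟶β-head S (app₃β {t} {u} s) with appendBody-⟶β-head (weakenG S) s
... | e , s' , eq = app t u e , app₃β s' , cong (λ z → appendBody (pn t) (garg (pn u) z)) eq

appendBody-⟶β-arg : ∀ h {u u'} v → u ⟶β u' → appendBody h (garg u v) ⟶β appendBody h (garg u' v)
appendBody-⟶β-arg (var n)     v s = app₂β s
appendBody-⟶β-arg (lam t)     v s = app₂β s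
appendBody-⟶β-arg (app a b c) v s =
  app₃β (appendBody-⟶β-arg c (ren (liftR suc) v) (ren-⟶β suc s))

appendBody-⟶β-body : ∀ h u {v v'} → v ⟶β v' → appendBody h (garg u v) ⟶β appendBody h (garg u v')
appendBody-⟶β-body (var n)     u s = app₃β s
appendBody-⟶β-body (lam t)     u s = app₃β s
appendBody-⟶β-body (app a b c) u s = app₃β (appendBody-⟶β-body c (weaken u) (ren-⟶β (liftR suc) s))

pn-⟶β : ∀ {a b} → a ⟶β b → ∃ λ d → (pn a ⟶β d) × (pn d ≡ pn b)
pn-⟶β (rootβ {t} {u} {v}) =
  pn v [ pn t [ pn u ] ] , rootβ ,
  trans (sym (pn-sub-pn (single (pn t [ pn u ])) v)) (pn-[]-cong (pn-[]-pn t u) v)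
pn-⟶β (lamβ s) with pn-⟶β s
... | d , s' , eq = lam d , lamβ s' , cong lam eq
pn-⟶β (app₁β {u = u} {v} s) with pn-⟶β s
... | d , s' , eq with appendBody-⟶β-head (garg (pn u) (pn v)) s'
... | e , s'' , eq' = e , s'' ,
  trans eq' (trans (pn-appendBody d (garg (pn u) (pn v)))
                   (appendBody-cong eq (pn-idem u) (pn-idem v)))
pn-⟶β (app₂β {t} {v = v} s) with pn-⟶β s
... | d , s' , eq = appendBody (pn t) (garg d (pn v)) , appendBody-⟶β-arg (pn t) (pn v) s' ,
  trans (pn-appendBody (pn t) (garg d (pn v))) (appendBody-cong (pn-idem t) eq (pn-idem v))
pn-⟶β (app₃β {t} {u} s) with pn-⟶β s
... | d , s' , eq = appendBody (pn t) (garg (pn u) d) , appendBody-⟶β-body (pn t) (pn u) s' ,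
  trans (pn-appendBody (pn t) (garg (pn u) d)) (appendBody-cong (pn-idem t) (pn-idem u) eq)

pn-⟶ : ∀ {a b} → a ⟶ b → pn a ⟶* pn b
pn-⟶ s with ⟶⇒⟶β⊎pn≡ s
... | inj₂ eq = ≡⇒⟶* eq
... | inj₁ s' with pn-⟶β s'
... | d , s'' , eq = ⟶β⇒⟶ s'' ◅ (⟶*pn d ◅◅ ≡⇒⟶* eq)

pn-⟶* : ∀ {a b} → a ⟶* b → pn a ⟶* pn b
pn-⟶* = kleisliStar pn pn-⟶

pn-app-⟶* : ∀ {t t' u u' v v'} → pn t ⟶* pn t' → pn u ⟶* pn u' → pn v ⟶* pn v' →
            pn (app t u v) ⟶* pn (app t' u' v')
pn-app-⟶* {t} {t'} {u} {u'} {v} {v'} r₁ r₂ r₃ =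
  ≡⇒⟶* (sym (pn-app-pn t u v)) ◅◅ pn-⟶* (app* r₁ r₂ r₃) ◅◅ ≡⇒⟶* (pn-app-pn t' u' v')
  where
  pn-app-pn : ∀ t u v → pn (app (pn t) (pn u) (pn v)) ≡ pn (app t u v)
  pn-app-pn t u v = appendBody-cong (pn-idem t) (pn-idem u) (pn-idem v)

pn-sub-⟶* : ∀ (σ : Sub) {a b} → a ⟶* b → pn (sub σ a) ⟶* pn (sub σ b)
pn-sub-⟶* σ = kleisliStar (pn ∘ sub σ) step
  where
  step : ∀ {a b} → a ⟶ b → pn (sub σ a) ⟶* pn (sub σ b)
  step {a} {b} s with ⟶⇒⟶β⊎pn≡ s
  ... | inj₁ s' = pn-⟶ (⟶β⇒⟶ (sub-⟶β σ s'))
  ... | inj₂ eq = ≡⇒⟶* (trans (pn-sub-pn σ a)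
                         (trans (cong (pn ∘ sub σ) eq) (sym (pn-sub-pn σ b))))

liftS-pn-⟶* : ∀ {σ σ' : Sub} → (∀ n → pn (σ n) ⟶* pn (σ' n)) →
              ∀ n → pn (liftS σ n) ⟶* pn (liftS σ' n)
liftS-pn-⟶* r zero = ε
liftS-pn-⟶* {σ} {σ'} r (suc n) =
  ≡⇒⟶* (pn-ren suc (σ n)) ◅◅ ren-⟶* suc (r n) ◅◅ ≡⇒⟶* (sym (pn-ren suc (σ' n)))

pn-subˢ-⟶* : ∀ {σ σ' : Sub} → (∀ n → pn (σ n) ⟶* pn (σ' n)) →
             ∀ t → pn (sub σ t) ⟶* pn (sub σ' t)
pn-subˢ-⟶* r (var n)     = r n
pn-subˢ-⟶* r (lam t)     = lam* (pn-subˢ-⟶* (liftS-pn-⟶* r) t)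
pn-subˢ-⟶* {σ} {σ'} r (app t u v) =
  pn-app-⟶* {sub σ t} {sub σ' t} {sub σ u} {sub σ' u} {sub (liftS σ) v} {sub (liftS σ') v}
    (pn-subˢ-⟶* r t) (pn-subˢ-⟶* r u) (pn-subˢ-⟶* (liftS-pn-⟶* r) v)

pn-[]-⟶* : ∀ v v' w w' → pn v ⟶* pn v' → pn w ⟶* pn w' → pn (v [ w ]) ⟶* pn (v' [ w' ])
pn-[]-⟶* v v' w w' r₁ r₂ =
  ≡⇒⟶* (pn-sub-pn (single w) v) ◅◅ pn-sub-⟶* (single w) r₁ ◅◅ ≡⇒⟶* (sym (pn-sub-pn (single w) v'))
  ◅◅ pn-subˢ-⟶* pointwise v'
  where
  pointwise : ∀ n → pn (single w n) ⟶* pn (single w' n)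
  pointwise zero    = r₂
  pointwise (suc n) = ε

-- Development

contract : Tm → Tm → Tm → Tm
contract (var n)     u v = app (var n) u v
contract (lam t)     u v = pn (v [ t [ u ] ])
contract (app a b c) u v = appendBody (app a b c) (garg u v)

develop : Tm → Tm
develop (var n)     = var n
develop (lam t)     = lam (develop t)
develop (app t u v) = contract (develop t) (develop u) (develop v)

πNF-contract : ∀ {h u v} → πNF h → πNF u → πNF v → πNF (contract h u v)
πNF-contract nvar                     nu nv = napv nu nv
πNF-contract {lam t} {u} {v} (nlam _) nu nv = πNF-pn (v [ t [ u ] ])
πNF-contract (napv x y)               nu nv = πNF-appendBody (napv x y) nu nv
πNF-contract (napl w x y)             nu nv = πNF-appendBody (napl w x y) nu nv

πNF-develop : ∀ t → πNF (develop t)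
πNF-develop (var n)     = nvar
πNF-develop (lam t)     = nlam (πNF-develop t)
πNF-develop (app t u v) = πNF-contract (πNF-develop t) (πNF-develop u) (πNF-develop v)

pn-develop : ∀ t → pn (develop t) ≡ develop t
pn-develop t = πNF⇒pn-id (πNF-develop t)

contract-ren : ∀ (ρ : Ren) h u v → contract (ren ρ h) (ren ρ u) (ren (liftR ρ) v) ≡ ren ρ (contract h u v)
contract-ren ρ (var n)     u v = refl
contract-ren ρ (lam t)     u v = trans (cong pn (sym (ren-β-contractum ρ t u v))) (pn-ren ρ (v [ t [ u ] ]))
contract-ren ρ (app a b c) u v = sym (ren-appendBody ρ (app a b c) (garg u v))

develop-ren : ∀ (ρ : Ren) t → develop (ren ρ t) ≡ ren ρ (develop t)
develop-ren ρ (var n)     = refl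
develop-ren ρ (lam t)     = cong lam (develop-ren (liftR ρ) t)
develop-ren ρ (app t u v) =
  trans (cong₃ contract (develop-ren ρ t) (develop-ren ρ u) (develop-ren (liftR ρ) v))
        (contract-ren ρ (develop t) (develop u) (develop v))

app⟶*contract : ∀ h u v → app h u v ⟶* contract h u v
app⟶*contract (var n)     u v = ε
app⟶*contract (lam t)     u v = root (β {t} {u} {v}) ◅ ⟶*pn (v [ t [ u ] ])
app⟶*contract (app a b c) u v = app⟶*appendBody (app a b c) u v

⟶*develop : ∀ t → t ⟶* develop t
⟶*develop (var n)     = ε
⟶*develop (lam t)     = lam* (⟶*develop t)
⟶*develop (app t u v) =
  app* (⟶*develop t) (⟶*develop u) (⟶*develop v) ◅◅ app⟶*contract (develop t) (develop u) (develop v)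

appendBody-⟶-arg : ∀ h {u u'} v → u ⟶ u' → appendBody h (garg u v) ⟶ appendBody h (garg u' v)
appendBody-⟶-arg (var n)     v s = app₂ s
appendBody-⟶-arg (lam t)     v s = app₂ s
appendBody-⟶-arg (app a b c) v s = app₃ (appendBody-⟶-arg c (ren (liftR suc) v) (ren-⟶ suc s))

appendBody-⟶-body : ∀ h u {v v'} → v ⟶ v' → appendBody h (garg u v) ⟶ appendBody h (garg u v')
appendBody-⟶-body (var n)     u s = app₃ s
appendBody-⟶-body (lam t)     u s = app₃ s
appendBody-⟶-body (app a b c) u s = app₃ (appendBody-⟶-body c (weaken u) (ren-⟶ (liftR suc) s))

appendBody-⟶* : ∀ h {u u' v v'} → u ⟶* u' → v ⟶* v' →
                appendBody h (garg u v) ⟶* appendBody h (garg u' v')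
appendBody-⟶* h {u' = u'} {v} r₁ r₂ =
  gmap (λ x → appendBody h (garg x v)) (appendBody-⟶-arg h v) r₁ ◅◅
  gmap (λ x → appendBody h (garg u' x)) (appendBody-⟶-body h u') r₂

developG-weakenG : ∀ u v →
  garg (develop (weaken u)) (develop (ren (liftR suc) v)) ≡ weakenG (garg (develop u) (develop v))
developG-weakenG u v = cong₂ garg (develop-ren suc u) (develop-ren (liftR suc) v)

appendBody-develop : ∀ {w} → πNF w → ∀ u v →
  appendBody (develop w) (garg (develop u) (develop v)) ⟶* develop (appendBody w (garg u v))
appendBody-develop nvar u v = ε
appendBody-develop (nlam {t} _) u v = app⟶*contract (lam (develop t)) (develop u) (develop v)
appendBody-develop (napv {v = b} _ nb) u v = app₃*
  (≡⇒⟶* (cong (appendBody (develop b)) (sym (developG-weakenG u v)))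
   ◅◅ appendBody-develop nb (weaken u) (ren (liftR suc) v))
appendBody-develop (napl {t} {a} {b} _ _ nb) u v =
  ≡⇒⟶* pulled-in ◅◅
  pn-sub-⟶* (single W) (≡⇒⟶* (cong (appendBody (develop b)) (sym (developG-weakenG u v)))
                        ◅◅ appendBody-develop nb (weaken u) (ren (liftR suc) v))
  where
  W : Tm
  W = develop t [ develop a ]
  S : GArg
  S = garg (develop u) (develop v)
  pulled-in : appendBody (pn (develop b [ W ])) S ≡ pn (sub (single W) (appendBody (develop b) (weakenG S)))
  pulled-in = sym (trans (pn-sub-appendBody (single W) (develop b) (weakenG S))
    (cong (appendBody (pn (develop b [ W ])))
      (trans (cong pnG (subG-single-weakenG W S)) (cong₂ garg (pn-develop u) (pn-develop v)))))

liftS-πNF : ∀ {σ : Sub} → (∀ n → πNF (σ n)) → ∀ n → πNF (liftS σ n)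
liftS-πNF nσ zero    = nvar
liftS-πNF nσ (suc n) = πNF-ren suc (nσ n)

liftS-develop : ∀ {σ τ : Sub} → (∀ n → τ n ≡ develop (σ n)) → ∀ n → liftS τ n ≡ develop (liftS σ n)
liftS-develop         e zero    = refl
liftS-develop {σ} {τ} e (suc n) = trans (cong weaken (e n)) (sym (develop-ren suc (σ n)))

pn-β-contractum-⟶* : ∀ t t' u u' v v' → pn t ⟶* pn t' → pn u ⟶* pn u' → pn v ⟶* pn v' →
                     pn (v [ t [ u ] ]) ⟶* pn (v' [ t' [ u' ] ])
pn-β-contractum-⟶* t t' u u' v v' rt ru rv =
  pn-[]-⟶* v v' (t [ u ]) (t' [ u' ]) rv (pn-[]-⟶* t t' u u' rt ru)

pn-sub-develop : ∀ {t} → πNF t → ∀ (σ τ : Sub) → (∀ n → πNF (σ n)) → (∀ n → τ n ≡ develop (σ n)) →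
                 pn (sub τ (develop t)) ⟶* develop (pn (sub σ t))
pn-sub-develop (nvar {k}) σ τ nσ e =
  ≡⇒⟶* (trans (cong pn (e k)) (trans (pn-develop (σ k)) (cong develop (sym (πNF⇒pn-id (nσ k))))))
pn-sub-develop (nlam nt) σ τ nσ e =
  lam* (pn-sub-develop nt (liftS σ) (liftS τ) (liftS-πNF nσ) (liftS-develop e))
pn-sub-develop (napv {k} {u} {v} nu nv) σ τ nσ e =
  ≡⇒⟶* (cong (λ z → appendBody z (garg (pn (sub τ (develop u))) (pn (sub (liftS τ) (develop v)))))
             (trans (cong pn (e k)) (pn-develop (σ k))))
  ◅◅ appendBody-⟶* (develop (σ k))
       (pn-sub-develop nu σ τ nσ e)
       (pn-sub-develop nv (liftS σ) (liftS τ) (liftS-πNF nσ) (liftS-develop e))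
  ◅◅ appendBody-develop (nσ k) (pn (sub σ u)) (pn (sub (liftS σ) v))
  ◅◅ ≡⇒⟶* (cong (λ z → develop (appendBody z (garg (pn (sub σ u)) (pn (sub (liftS σ) v)))))
                 (sym (πNF⇒pn-id (nσ k))))
pn-sub-develop (napl {t} {u} {v} nt nu nv) σ τ nσ e =
  ≡⇒⟶* (trans (sym (pn-sub-pn τ (develop v [ develop t [ develop u ] ])))
              (cong pn (sub-β-contractum τ (develop t) (develop u) (develop v))))
  ◅◅ pn-β-contractum-⟶*
       (sub (liftS τ) (develop t)) (develop (pn (sub (liftS σ) t)))
       (sub τ (develop u))         (develop (pn (sub σ u)))
       (sub (liftS τ) (develop v)) (develop (pn (sub (liftS σ) v)))
       (under-binder nt) (pn-sub-develop nu σ τ nσ e ◅◅ ≡⇒⟶* (sym (pn-develop (pn (sub σ u))))) (under-binder nv)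
  where
  under-binder : ∀ {x} → πNF x → pn (sub (liftS τ) (develop x)) ⟶* pn (develop (pn (sub (liftS σ) x)))
  under-binder {x} nx = pn-sub-develop nx (liftS σ) (liftS τ) (liftS-πNF nσ) (liftS-develop e)
                        ◅◅ ≡⇒⟶* (sym (pn-develop (pn (sub (liftS σ) x))))

pn-[]-develop : ∀ {t w} → πNF t → πNF w → pn (develop t [ develop w ]) ⟶* develop (pn (t [ w ]))
pn-[]-develop {w = w} nt nw = pn-sub-develop nt (single w) (single (develop w)) nσ e
  where
  nσ : ∀ n → πNF (single w n)
  nσ zero    = nw
  nσ (suc n) = nvar
  e : ∀ n → single (develop w) n ≡ develop (single w n)
  e zero    = refl
  e (suc n) = refl

β-contractum-⟶*-develop : ∀ t' u' v' t u v →
  pn t' ⟶* pn (develop t) → pn u' ⟶* pn (develop u) → pn v' ⟶* pn (develop v) →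
  v' [ t' [ u' ] ] ⟶* develop (app (lam t) u v)
β-contractum-⟶*-develop t' u' v' t u v rt ru rv =
  ⟶*pn (v' [ t' [ u' ] ]) ◅◅ pn-β-contractum-⟶* t' (develop t) u' (develop u) v' (develop v) rt ru rv

⟶β⇒⟶*develop : ∀ {c d} → πNF c → c ⟶β d → d ⟶* develop c
⟶β⇒⟶*develop (napl {t} {u} {v} _ _ _) rootβ =
  β-contractum-⟶*-develop t u v t u v
    (pn-⟶* (⟶*develop t)) (pn-⟶* (⟶*develop u)) (pn-⟶* (⟶*develop v))
⟶β⇒⟶*develop (nlam nt)   (lamβ s)  = lam* (⟶β⇒⟶*develop nt s)
⟶β⇒⟶*develop (napv _ _)  (app₁β ())
⟶β⇒⟶*develop (napv nu _) (app₂β s) = app* ε (⟶β⇒⟶*develop nu s) (⟶*develop _)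
⟶β⇒⟶*develop (napv _ nv) (app₃β s) = app* ε (⟶*develop _) (⟶β⇒⟶*develop nv s)
⟶β⇒⟶*develop (napl {t} {u} {v} nt _ _) (app₁β (lamβ {t' = t'} s)) =
  root β ◅ β-contractum-⟶*-develop t' u v t u v
             (pn-⟶* (⟶β⇒⟶*develop nt s)) (pn-⟶* (⟶*develop u)) (pn-⟶* (⟶*develop v))
⟶β⇒⟶*develop (napl {t} {u} {v} _ nu _) (app₂β {u' = u'} s) =
  root β ◅ β-contractum-⟶*-develop t u' v t u v
             (pn-⟶* (⟶*develop t)) (pn-⟶* (⟶β⇒⟶*develop nu s)) (pn-⟶* (⟶*develop v))
⟶β⇒⟶*develop (napl {t} {u} {v} _ _ nv) (app₃β {v' = v'} s) =
  root β ◅ β-contractum-⟶*-develop t u v' t u v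
             (pn-⟶* (⟶*develop t)) (pn-⟶* (⟶*develop u)) (pn-⟶* (⟶β⇒⟶*develop nv s))

develop-pn : ∀ {x} → πNF x → pn (develop x) ⟶* pn (develop (pn x))
develop-pn nx = ≡⇒⟶* (cong (pn ∘ develop) (sym (πNF⇒pn-id nx)))

develop-⟶β : ∀ {c d} → πNF c → c ⟶β d → develop c ⟶* develop (pn d)
develop-⟶β (napl {t} {u} {v} nt nu nv) rootβ =
  pn-[]-⟶* (develop v) (develop v) (develop t [ develop u ]) (develop (pn (t [ u ]))) ε
    (pn-[]-develop nt nu ◅◅ ≡⇒⟶* (sym (pn-develop (pn (t [ u ])))))
  ◅◅ pn-[]-develop nv (πNF-pn (t [ u ]))
  ◅◅ ≡⇒⟶* (cong develop (pn-[]-cong (pn-idem (t [ u ])) v))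
develop-⟶β (nlam nt)     (lamβ s)  = lam* (develop-⟶β nt s)
develop-⟶β (napv _ _)    (app₁β ())
develop-⟶β (napv nu nv)  (app₂β s) = app* ε (develop-⟶β nu s) (≡⇒⟶* (cong develop (sym (πNF⇒pn-id nv))))
develop-⟶β (napv nu nv)  (app₃β s) = app* ε (≡⇒⟶* (cong develop (sym (πNF⇒pn-id nu)))) (develop-⟶β nv s)
develop-⟶β (napl {t} {u} {v} nt nu nv) (app₁β (lamβ {t' = t'} s)) =
  pn-β-contractum-⟶* (develop t) (develop (pn t')) (develop u) (develop (pn u)) (develop v) (develop (pn v))
    (pn-⟶* (develop-⟶β nt s)) (develop-pn nu) (develop-pn nv)
develop-⟶β (napl {t} {u} {v} nt nu nv) (app₂β {u' = u'} s) =
  pn-β-contractum-⟶* (develop t) (develop (pn t)) (develop u) (develop (pn u')) (develop v) (develop (pn v))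
    (develop-pn nt) (pn-⟶* (develop-⟶β nu s)) (develop-pn nv)
develop-⟶β (napl {t} {u} {v} nt nu nv) (app₃β {v' = v'} s) =
  pn-β-contractum-⟶* (develop t) (develop (pn t)) (develop u) (develop (pn u)) (develop v) (develop (pn v'))
    (develop-pn nt) (develop-pn nu) (pn-⟶* (develop-⟶β nv s))

zmap : Tm → Tm
zmap t = develop (pn t)

zmap-Z : HasZProperty _⟶_ zmap
zmap-Z {a} {b} s with ⟶⇒⟶β⊎pn≡ s
... | inj₂ eq = (⟶*pn b ◅◅ ≡⇒⟶* (sym eq) ◅◅ ⟶*develop (pn a)) , ≡⇒⟶* (cong develop eq)
... | inj₁ s' with pn-⟶β s'
... | d , s'' , eq =
  (⟶*pn b ◅◅ ≡⇒⟶* (sym eq) ◅◅ pn-⟶* (⟶β⇒⟶*develop (πNF-pn a) s'') ◅◅ ≡⇒⟶* (pn-develop (pn a))) ,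
  (develop-⟶β (πNF-pn a) s'' ◅◅ ≡⇒⟶* (cong develop eq))

theorem3p2 : Confluent
theorem3p2 = Z⇒confluent zmap-Z
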